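{- Let $m,n\in\mathbb{N}$ with $m\leqslant n-1$. Define $$\mathcal{F}_{n,m}=\{F\subset\{1,\ldots,n\}:\ F \text{ is Schreier and sparse},\ n\in F,\ \min F=m\}.$$ Then $|\mathcal{F}_{n,m+1}|=p(n-1,m)$, where $p(u,k)$ denotes the number of partitions of $u$ into exactly $k$ parts.
   Context: $\mathbb{N}=\{1,2,3,\ldots\}$. A set $A\subset\mathbb{N}$ is Schreier if $A$ is empty or $\min A\geqslant |A|$. A set $A=\{a_1<\cdots<a_n\}\subset\mathbb{N}$ is sparse if either $|A|\leqslant 2$, or $|A|\geqslant 3$ and $a_i-a_{i-1}\geqslant a_{i-1}-a_{i-2}$ for all $3\leqslant i\leqslant n$. -}

module Defs where

open import Data.Nat using (ℕ; zero; suc; _+_; _∸_; _≤_; _≤?_; _≟_)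
open import Data.List using (List; []; _∷_; _∷ʳ_; _++_; map; concatMap; length; filter; upTo)
open import Data.Nat.ListAction using (sum)
open import Data.List.Membership.Propositional using (_∈_)
open import Data.List.Membership.DecPropositional _≟_ using (_∈?_)
open import Data.Unit using (⊤; tt)
open import Data.Empty using (⊥)
open import Data.Product using (_×_)
open import Relation.Nullary using (Dec; yes; no; ¬_)
open import Relation.Nullary.Decidable using (_×-dec_)
open import Relation.Binary.PropositionalEquality using (_≡_)

-- Finite subsets of ℕ are represented as strictly increasing lists.

subsetsUpTo : ℕ → List (List ℕ)
subsetsUpTo zero = [] ∷ []
subsetsUpTo (suc n) = subsetsUpTo n ++ map (_∷ʳ suc n) (subsetsUpTo n)

-- Schreier: A empty or min A ≥ |A|  (min of an increasing list is its head)
Schreier : List ℕ → Set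
Schreier [] = ⊤
Schreier (a ∷ as) = length (a ∷ as) ≤ a

Sparse : List ℕ → Set
Sparse (a ∷ b ∷ c ∷ rest) = (b ∸ a ≤ c ∸ b) × Sparse (b ∷ c ∷ rest)
Sparse _ = ⊤

MinIs : ℕ → List ℕ → Set
MinIs m [] = ⊥
MinIs m (a ∷ _) = a ≡ m

schreier? : (A : List ℕ) → Dec (Schreier A)
schreier? [] = yes tt
schreier? (a ∷ as) = length (a ∷ as) ≤? a

sparse? : (A : List ℕ) → Dec (Sparse A)
sparse? [] = yes tt
sparse? (_ ∷ []) = yes tt
sparse? (_ ∷ _ ∷ []) = yes tt
sparse? (a ∷ b ∷ c ∷ rest) = (b ∸ a ≤? c ∸ b) ×-dec sparse? (b ∷ c ∷ rest)

minIs? : (m : ℕ) (A : List ℕ) → Dec (MinIs m A)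
minIs? m [] = no λ ()
minIs? m (a ∷ _) = a ≟ m

InF : ℕ → ℕ → List ℕ → Set
InF n m F = Schreier F × Sparse F × (n ∈ F) × MinIs m F

inF? : (n m : ℕ) (F : List ℕ) → Dec (InF n m F)
inF? n m F = schreier? F ×-dec sparse? F ×-dec (n ∈? F) ×-dec minIs? m F

𝓕 : ℕ → ℕ → List (List ℕ)
𝓕 n m = filter (inF? n m) (subsetsUpTo n)

tuples : ℕ → ℕ → List (List ℕ)
tuples u zero = [] ∷ []
tuples u (suc k) = concatMap (λ x → map (x ∷_) (tuples u k)) (map suc (upTo u))

NonIncreasing : List ℕ → Set
NonIncreasing (a ∷ b ∷ rest) = b ≤ a × NonIncreasing (b ∷ rest)
NonIncreasing _ = ⊤

nonIncreasing? : (A : List ℕ) → Dec (NonIncreasing A)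
nonIncreasing? [] = yes tt
nonIncreasing? (_ ∷ []) = yes tt
nonIncreasing? (a ∷ b ∷ rest) = (b ≤? a) ×-dec nonIncreasing? (b ∷ rest)

-- A partition of u into k parts: a non-increasing list of k positive integers summing to u
-- (every part is then ≤ u, so it suffices to search among `tuples u k`).
IsPartition : ℕ → List ℕ → Set
IsPartition u P = NonIncreasing P × sum P ≡ u

isPartition? : (u : ℕ) (P : List ℕ) → Dec (IsPartition u P)
isPartition? u P = nonIncreasing? P ×-dec (sum P ≟ u)

p : ℕ → ℕ → ℕ
p u k = length (filter (isPartition? u) (tuples u k))

{-# OPTIONS --safe #-}
-- A member F = {f₁ < ⋯ < f_k} of 𝓕_{n,m+1} is determined by its list of gaps
-- D = (f₂ − f₁, …, f_k − f_{k-1}), being the partial sums of D starting at f₁ = m + 1.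
-- Sparseness says exactly that D is non-decreasing, f_k = n says that the (positive)
-- gaps sum to n − 1 − m, and the Schreier condition k ≤ m + 1 says that D has at most
-- m entries. Adding one to every gap and filling up with ones to m entries turns these
-- gap lists bijectively into the partitions of n − 1 into exactly m parts, listed in
-- ascending order; reversing the list gives the non-increasing form counted by p.
module Submission where

open import Defs
open import Data.Nat using (ℕ; zero; suc; pred; _+_; _∸_; _≤_; _<_; _≥_; z≤n; s≤s; s≤s⁻¹; z<s; _≟_)
open import Data.Nat.Properties
open import Algebra.Properties.CommutativeSemigroup +-commutativeSemigroup using (x∙yz≈y∙xz)
open import Data.Nat.ListAction using (sum)
open import Data.Nat.ListAction.Properties using (sum-++; sum-↭)
open import Data.List
  using (List; []; _∷_; _∷ʳ_; _++_; _ʳ++_; map; concatMap; cartesianProductWith; length; filter; upTo; replicate; reverse;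
         initLast; _∷ʳ′_)
open import Data.List.Properties
  using (length-map; length-++; length-replicate; length-reverse; length-filter; map-∘; map-id; map-id-local; map-++;
         map-replicate; filter-++; filter-all; filter-none; ∷ʳ-injectiveˡ; ∷-injective; reverse-involutive)
open import Data.List.Scans.Base using (scanl)
open import Data.List.Membership.Propositional using (_∈_)
open import Data.List.Membership.Propositional.Properties
  using (∈-map⁺; ∈-map⁻; ∈-++⁺ˡ; ∈-++⁺ʳ; ∈-++⁻; ∈-filter⁺; ∈-filter⁻; ∈-upTo⁺; ∈-upTo⁻;
         ∈-cartesianProductWith⁺; ∈-cartesianProductWith⁻)
open import Data.List.Membership.Propositional.Properties.WithK using (unique∧set⇒bag)
open import Data.List.Relation.Binary.BagAndSetEquality using (∼bag⇒↭)
open import Data.List.Relation.Binary.Permutation.Propositional using (↭-sym)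
open import Data.List.Relation.Binary.Permutation.Propositional.Properties using (↭-length; ↭-reverse; All-resp-↭)
open import Data.List.Relation.Unary.All as All using (All; []; _∷_)
import Data.List.Relation.Unary.All.Properties as All
open import Data.List.Relation.Unary.Any using (here; there)
open import Data.List.Relation.Unary.Linked as Linked using (Linked; []; [-]; _∷_)
import Data.List.Relation.Unary.Linked.Properties as Linked
open import Data.List.Relation.Unary.Unique.Propositional using (Unique; []; _∷_)
import Data.List.Relation.Unary.Unique.Propositional.Properties as Unique
open import Data.Product using (_×_; _,_; proj₁; proj₂)
open import Data.Sum using (inj₁; inj₂)
open import Data.Unit using (tt)
open import Data.Empty using (⊥)
open import Function using (_∘_; flip; id)
open import Function.Bundles using (mk⇔)
open import Level using (Level; 0ℓ)
open import Relation.Binary.Core using (Rel)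
open import Relation.Binary.Definitions using (Transitive)
open import Relation.Nullary.Decidable using (_×-dec_)
open import Relation.Unary using (Pred; Decidable)
open import Relation.Binary.PropositionalEquality using (_≡_; refl; sym; trans; cong; cong₂; subst; module ≡-Reasoning)

private
  variable
    a b c ℓ : Level
    A : Set a
    B : Set b
    C : Set c

module _ {xs : List A} {ys : List B} (f : A → B) (g : B → A) where

  length-≡-by-inverse : Unique xs → Unique ys →
                        (∀ {x} → x ∈ xs → f x ∈ ys) → (∀ {y} → y ∈ ys → g y ∈ xs) →
                        (∀ {x} → x ∈ xs → g (f x) ≡ x) → (∀ {y} → y ∈ ys → f (g y) ≡ y) →
                        length xs ≡ length ys
  length-≡-by-inverse xs! ys! f∈ g∈ gf fg = begin
    length xs         ≡⟨ length-map f xs ⟨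
    length (map f xs) ≡⟨ ↭-length (∼bag⇒↭ (unique∧set⇒bag fxs! ys! (mk⇔ to from))) ⟩
    length ys         ∎
    where
    open ≡-Reasoning
    fxs! : Unique (map f xs)
    fxs! = Unique.map⁻ {f = g} (subst Unique (sym (trans (sym (map-∘ xs)) (map-id-local (All.tabulate gf)))) xs!)
    to : ∀ {y} → y ∈ map f xs → y ∈ ys
    to y∈ with _ , x∈ , refl ← ∈-map⁻ f y∈ = f∈ x∈
    from : ∀ {y} → y ∈ ys → y ∈ map f xs
    from y∈ = subst (_∈ map f xs) (fg y∈) (∈-map⁺ f (g∈ y∈))

module _ {R : Rel A ℓ} where

  Linked-∷⁺ : ∀ {x xs} → All (R x) xs → Linked R xs → Linked R (x ∷ xs)
  Linked-∷⁺ []      [] = [-]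
  Linked-∷⁺ (r ∷ _) l  = r ∷ l

  Linked-∷ʳ⁺ : ∀ {xs x} → All (λ y → R y x) xs → Linked R xs → Linked R (xs ∷ʳ x)
  Linked-∷ʳ⁺ []                 []      = [-]
  Linked-∷ʳ⁺ (r ∷ [])           [-]     = r ∷ [-]
  Linked-∷ʳ⁺ (_ ∷ rs@(_ ∷ _))   (s ∷ l) = s ∷ Linked-∷ʳ⁺ rs l

  Linked-∷ʳ⁻ : Transitive R → ∀ xs {x} → Linked R (xs ∷ʳ x) → Linked R xs × All (λ y → R y x) xs
  Linked-∷ʳ⁻ _     []           _       = [] , []
  Linked-∷ʳ⁻ _     (_ ∷ [])     (r ∷ _) = [-] , r ∷ []
  Linked-∷ʳ⁻ trans (_ ∷ y ∷ xs) (r ∷ l) with Linked-∷ʳ⁻ trans (y ∷ xs) l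
  ... | l′ , (yx ∷ rs) = r ∷ l′ , trans r yx ∷ yx ∷ rs

  Linked-ʳ++⁺ : ∀ {x xs acc} → Linked R (x ∷ xs) → Linked (flip R) (x ∷ acc) →
                Linked (flip R) ((x ∷ xs) ʳ++ acc)
  Linked-ʳ++⁺ [-]     l′ = l′
  Linked-ʳ++⁺ (r ∷ l) l′ = Linked-ʳ++⁺ l (r ∷ l′)

  Linked-reverse⁺ : ∀ {xs} → Linked R xs → Linked (flip R) (reverse xs)
  Linked-reverse⁺ {[]}    [] = []
  Linked-reverse⁺ {_ ∷ _} l  = Linked-ʳ++⁺ l [-]

concatMap-map≡cartesianProductWith : ∀ (f : A → B → C) xs ys →
                                     concatMap (λ x → map (f x) ys) xs ≡ cartesianProductWith f xs ys
concatMap-map≡cartesianProductWith f []       ys = refl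
concatMap-map≡cartesianProductWith f (x ∷ xs) ys = cong (map (f x) ys ++_) (concatMap-map≡cartesianProductWith f xs ys)

All-≤-sum : ∀ xs → All (_≤ sum xs) xs
All-≤-sum []       = []
All-≤-sum (x ∷ xs) = m≤m+n x (sum xs) ∷ All.map (λ y≤ → ≤-trans y≤ (m≤n+m (sum xs) x)) (All-≤-sum xs)

sum-replicate-1 : ∀ k → sum (replicate k 1) ≡ k
sum-replicate-1 zero    = refl
sum-replicate-1 (suc k) = cong suc (sum-replicate-1 k)

sum-map-suc : ∀ xs → sum (map suc xs) ≡ length xs + sum xs
sum-map-suc []       = refl
sum-map-suc (x ∷ xs) = cong suc (trans (cong (x +_) (sum-map-suc xs)) (x∙yz≈y∙xz x (length xs) (sum xs)))

InRange : ℕ → ℕ → Set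
InRange n x = 0 < x × x ≤ n

InRange-suc : ∀ {n x} → InRange n x → InRange (suc n) x
InRange-suc (0<x , x≤n) = 0<x , m≤n⇒m≤1+n x≤n

∈-subsetsUpTo⁻ : ∀ n {X} → X ∈ subsetsUpTo n → Linked _<_ X × All (InRange n) X
∈-subsetsUpTo⁻ zero    (here refl) = [] , []
∈-subsetsUpTo⁻ (suc n) X∈ with ∈-++⁻ (subsetsUpTo n) X∈
... | inj₁ X∈′ = let l , r = ∈-subsetsUpTo⁻ n X∈′ in l , All.map InRange-suc r
... | inj₂ X∈′ with Y , Y∈ , refl ← ∈-map⁻ (_∷ʳ suc n) X∈′ =
  let l , r = ∈-subsetsUpTo⁻ n Y∈ in
  Linked-∷ʳ⁺ (All.map (s≤s ∘ proj₂) r) l , All.++⁺ (All.map InRange-suc r) ((z<s , ≤-refl) ∷ [])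

∈-subsetsUpTo⁺ : ∀ n {X} → Linked _<_ X → All (InRange n) X → X ∈ subsetsUpTo n
∈-subsetsUpTo⁺ zero    {[]}          _ _                  = here refl
∈-subsetsUpTo⁺ zero    {zero ∷ _}    _ ((() , _) ∷ _)
∈-subsetsUpTo⁺ zero    {suc _ ∷ _}   _ ((_ , ()) ∷ _)
∈-subsetsUpTo⁺ (suc n) {X}           l r with initLast X
... | []      = ∈-++⁺ˡ (∈-subsetsUpTo⁺ n [] [])
... | Y ∷ʳ′ x with Linked-∷ʳ⁻ <-trans Y l | All.++⁻ Y r
... | lY , Y<x | rY , ((0<x , x≤1+n) ∷ []) with m≤n⇒m<n∨m≡n x≤1+n
... | inj₂ refl = ∈-++⁺ʳ (subsetsUpTo n) (∈-map⁺ (_∷ʳ suc n)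
                    (∈-subsetsUpTo⁺ n lY (All.zipWith (λ ((0<y , _) , y<1+n) → 0<y , s≤s⁻¹ y<1+n) (rY , Y<x))))
... | inj₁ (s≤s x≤n) = ∈-++⁺ˡ (∈-subsetsUpTo⁺ n l (All.++⁺
                    (All.zipWith (λ ((0<y , _) , y<x) → 0<y , ≤-trans (<⇒≤ y<x) x≤n) (rY , Y<x)) ((0<x , x≤n) ∷ [])))

subsetsUpTo-unique : ∀ n → Unique (subsetsUpTo n)
subsetsUpTo-unique zero    = [] ∷ []
subsetsUpTo-unique (suc n) =
  Unique.++⁺ (subsetsUpTo-unique n) (Unique.map⁺ (∷ʳ-injectiveˡ _ _) (subsetsUpTo-unique n)) disjoint
  where
  disjoint : ∀ {X} → X ∈ subsetsUpTo n × X ∈ map (_∷ʳ suc n) (subsetsUpTo n) → ⊥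
  disjoint (X∈ , X∈′) with Y , _ , refl ← ∈-map⁻ (_∷ʳ suc n) X∈′ =
    <-irrefl refl (proj₂ (All.lookup (proj₂ (∈-subsetsUpTo⁻ n X∈)) (∈-++⁺ʳ Y (here refl))))

∈-map-suc-upTo⁻ : ∀ {n x} → x ∈ map suc (upTo n) → InRange n x
∈-map-suc-upTo⁻ x∈ with _ , y∈ , refl ← ∈-map⁻ suc x∈ = z<s , ∈-upTo⁻ y∈

∈-map-suc-upTo⁺ : ∀ {n x} → InRange n x → x ∈ map suc (upTo n)
∈-map-suc-upTo⁺ {x = suc x} (_ , x<n) = ∈-map⁺ suc (∈-upTo⁺ x<n)

tuples-suc : ∀ u k → tuples u (suc k) ≡ cartesianProductWith _∷_ (map suc (upTo u)) (tuples u k)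
tuples-suc u k = concatMap-map≡cartesianProductWith _∷_ (map suc (upTo u)) (tuples u k)

∈-tuples⁻ : ∀ u k {P} → P ∈ tuples u k → length P ≡ k × All (InRange u) P
∈-tuples⁻ u zero    (here refl) = refl , []
∈-tuples⁻ u (suc k) {P} P∈
  with x , Q , x∈ , Q∈ , refl ← ∈-cartesianProductWith⁻ _∷_ (map suc (upTo u)) (tuples u k)
                                  (subst (P ∈_) (tuples-suc u k) P∈) =
  let l , r = ∈-tuples⁻ u k Q∈ in cong suc l , ∈-map-suc-upTo⁻ x∈ ∷ r

∈-tuples⁺ : ∀ u k {P} → length P ≡ k → All (InRange u) P → P ∈ tuples u k
∈-tuples⁺ u zero    {[]}    _ _       = here refl
∈-tuples⁺ u (suc k) {x ∷ P} l (x∈ ∷ r) = subst (_ ∈_) (sym (tuples-suc u k))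
  (∈-cartesianProductWith⁺ _∷_ (∈-map-suc-upTo⁺ x∈) (∈-tuples⁺ u k (suc-injective l) r))

tuples-unique : ∀ u k → Unique (tuples u k)
tuples-unique u zero    = [] ∷ []
tuples-unique u (suc k) = subst Unique (sym (tuples-suc u k))
  (Unique.cartesianProductWith⁺ _∷_ ∷-injective (Unique.map⁺ suc-injective (Unique.upTo⁺ u)) (tuples-unique u k))

reverse-∈-tuples : ∀ u k {P} → P ∈ tuples u k → reverse P ∈ tuples u k
reverse-∈-tuples u k {P} P∈ = let l , r = ∈-tuples⁻ u k P∈ in
  ∈-tuples⁺ u k (trans (length-reverse P) l) (All-resp-↭ (↭-sym (↭-reverse P)) r)

gaps : List ℕ → List ℕ
gaps (x ∷ y ∷ xs) = (y ∸ x) ∷ gaps (y ∷ xs)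
gaps _            = []

length-gaps : ∀ x xs → length (gaps (x ∷ xs)) ≡ length xs
length-gaps x []       = refl
length-gaps x (y ∷ xs) = cong suc (length-gaps y xs)

length-scanl : ∀ x ds → length (scanl _+_ x ds) ≡ suc (length ds)
length-scanl x []       = refl
length-scanl x (d ∷ ds) = cong suc (length-scanl (x + d) ds)

gaps-scanl : ∀ x ds → gaps (scanl _+_ x ds) ≡ ds
gaps-scanl x []       = refl
gaps-scanl x (d ∷ ds) = cong₂ _∷_ (m+n∸m≡n x d) (gaps-scanl (x + d) ds)

scanl-gaps : ∀ {x xs} → Linked _≤_ (x ∷ xs) → scanl _+_ x (gaps (x ∷ xs)) ≡ x ∷ xs
scanl-gaps [-]                         = refl
scanl-gaps {x} (x≤y ∷ l) rewrite m+[n∸m]≡n x≤y = cong (x ∷_) (scanl-gaps l)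

scanl-bounds : ∀ x ds → All (λ y → x ≤ y × y ≤ x + sum ds) (scanl _+_ x ds)
scanl-bounds x []       = (≤-refl , m≤m+n x 0) ∷ []
scanl-bounds x (d ∷ ds) = (≤-refl , m≤m+n x (d + sum ds)) ∷
  All.map (λ (lo , hi) → ≤-trans (m≤m+n x d) lo , ≤-trans hi (≤-reflexive (+-assoc x d (sum ds))))
          (scanl-bounds (x + d) ds)

sum∈scanl : ∀ x ds → x + sum ds ∈ scanl _+_ x ds
sum∈scanl x []       = here (+-identityʳ x)
sum∈scanl x (d ∷ ds) = there (subst (_∈ scanl _+_ (x + d) ds) (+-assoc x d (sum ds)) (sum∈scanl (x + d) ds))

Linked-<-scanl : ∀ {x ds} → All (0 <_) ds → Linked _<_ (scanl _+_ x ds)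
Linked-<-scanl         []          = [-]
Linked-<-scanl {x} (0<d ∷ 0<ds) = m<m+n x 0<d ∷ Linked-<-scanl 0<ds

gaps-positive : ∀ {xs} → Linked _<_ xs → All (0 <_) (gaps xs)
gaps-positive []        = []
gaps-positive [-]       = []
gaps-positive (x<y ∷ l) = m<n⇒0<n∸m x<y ∷ gaps-positive l

Sparse⇒Linked-gaps : ∀ xs → Sparse xs → Linked _≤_ (gaps xs)
Sparse⇒Linked-gaps []               _       = []
Sparse⇒Linked-gaps (_ ∷ [])         _       = []
Sparse⇒Linked-gaps (_ ∷ _ ∷ [])     _       = [-]
Sparse⇒Linked-gaps (_ ∷ y ∷ z ∷ xs) (g , s) = g ∷ Sparse⇒Linked-gaps (y ∷ z ∷ xs) s

Linked-gaps⇒Sparse : ∀ xs → Linked _≤_ (gaps xs) → Sparse xs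
Linked-gaps⇒Sparse []               _       = tt
Linked-gaps⇒Sparse (_ ∷ [])         _       = tt
Linked-gaps⇒Sparse (_ ∷ _ ∷ [])     _       = tt
Linked-gaps⇒Sparse (_ ∷ y ∷ z ∷ xs) (g ∷ l) = g , Linked-gaps⇒Sparse (y ∷ z ∷ xs) l

Ascending : List ℕ → Set
Ascending xs = Linked _≤_ xs × All (0 <_) xs

AscPartitionAtMost : ℕ → ℕ → List ℕ → Set
AscPartitionAtMost m u ds = Ascending ds × length ds ≤ m × m + sum ds ≡ u

AscPartition : ℕ → ℕ → List ℕ → Set
AscPartition m u xs = Ascending xs × length xs ≡ m × sum xs ≡ u

∈-𝓕⁻ : ∀ {m u F} → F ∈ 𝓕 (suc u) (suc m) →
       F ≡ scanl _+_ (suc m) (gaps F) × AscPartitionAtMost m u (gaps F)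
∈-𝓕⁻ {m} {u} F∈ with ∈-filter⁻ (inF? (suc u) (suc m)) {xs = subsetsUpTo (suc u)} F∈
∈-𝓕⁻ {F = []}    _ | _ , (_ , _ , _ , ())
∈-𝓕⁻ {m} {u} {F = x ∷ xs} _ | F∈ , (schreier , sparse , n∈F , refl) =
  F≡ , (Sparse⇒Linked-gaps _ sparse , gaps-positive increasing) , length≤ , suc-injective (≤-antisym top≤n n≤top)
  where
  increasing : Linked _<_ (x ∷ xs)
  increasing = proj₁ (∈-subsetsUpTo⁻ (suc u) F∈)
  inRange : All (InRange (suc u)) (x ∷ xs)
  inRange = proj₂ (∈-subsetsUpTo⁻ (suc u) F∈)
  ds : List ℕ
  ds = gaps (x ∷ xs)
  F≡ : x ∷ xs ≡ scanl _+_ x ds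
  F≡ = sym (scanl-gaps (Linked.map <⇒≤ increasing))
  length≤ : length ds ≤ m
  length≤ = subst (_≤ m) (sym (length-gaps x xs)) (s≤s⁻¹ schreier)
  top≤n : x + sum ds ≤ suc u
  top≤n = proj₂ (All.lookup inRange (subst (x + sum ds ∈_) (sym F≡) (sum∈scanl x ds)))
  n≤top : suc u ≤ x + sum ds
  n≤top = proj₂ (All.lookup (scanl-bounds x ds) (subst (suc u ∈_) F≡ n∈F))

∈-𝓕⁺ : ∀ {m u ds} → AscPartitionAtMost m u ds → scanl _+_ (suc m) ds ∈ 𝓕 (suc u) (suc m)
∈-𝓕⁺ {m} {u} {ds} ((ascending , positive) , length≤ , sum≡) =
  ∈-filter⁺ (inF? (suc u) (suc m)) {xs = subsetsUpTo (suc u)}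
    (∈-subsetsUpTo⁺ (suc u) (Linked-<-scanl positive) inRange)
    (schreier , Linked-gaps⇒Sparse F (subst (Linked _≤_) (sym (gaps-scanl (suc m) ds)) ascending) ,
     subst (_∈ F) top≡n (sum∈scanl (suc m) ds) , refl)
  where
  F : List ℕ
  F = scanl _+_ (suc m) ds
  top≡n : suc m + sum ds ≡ suc u
  top≡n = cong suc sum≡
  inRange : All (InRange (suc u)) F
  inRange = All.map (λ (lo , hi) → <-≤-trans z<s lo , ≤-trans hi (≤-reflexive top≡n)) (scanl-bounds (suc m) ds)
  schreier : length F ≤ suc m
  schreier = ≤-trans (≤-reflexive (length-scanl (suc m) ds)) (s≤s length≤)

Ascending-ones++ : ∀ k {xs} → Ascending xs → Ascending (replicate k 1 ++ xs)
Ascending-ones++ zero    asc = asc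
Ascending-ones++ (suc k) asc = let l , pos = Ascending-ones++ k asc in Linked-∷⁺ pos l , z<s ∷ pos

Ascending-map-suc : ∀ {xs} → Linked _≤_ xs → Ascending (map suc xs)
Ascending-map-suc {xs} l = Linked.map⁺ (Linked.map s≤s l) , All.map⁺ (All.universal (λ _ → z<s) xs)

pad : ℕ → List ℕ → List ℕ
pad m ds = replicate (m ∸ length ds) 1 ++ map suc ds

unpad : List ℕ → List ℕ
unpad xs = filter (0 <?_) (map pred xs)

pad-suc : ∀ {n} ds → length ds ≤ n → pad (suc n) ds ≡ 1 ∷ pad n ds
pad-suc ds l = cong (λ k → replicate k 1 ++ map suc ds) (+-∸-assoc 1 l)

pad-length : ∀ ds → pad (length ds) ds ≡ map suc ds
pad-length ds = cong (λ k → replicate k 1 ++ map suc ds) (n∸n≡0 (length ds))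

length-pad : ∀ m ds → length ds ≤ m → length (pad m ds) ≡ m
length-pad m ds l = begin
  length (replicate k 1 ++ map suc ds)          ≡⟨ length-++ (replicate k 1) ⟩
  length (replicate k 1) + length (map suc ds)  ≡⟨ cong₂ _+_ (length-replicate k) (length-map suc ds) ⟩
  k + length ds                                 ≡⟨ m∸n+n≡m l ⟩
  m                                             ∎
  where
  open ≡-Reasoning
  k : ℕ
  k = m ∸ length ds

sum-pad : ∀ m ds → length ds ≤ m → sum (pad m ds) ≡ m + sum ds
sum-pad m ds l = begin
  sum (replicate k 1 ++ map suc ds)       ≡⟨ sum-++ (replicate k 1) (map suc ds) ⟩
  sum (replicate k 1) + sum (map suc ds)  ≡⟨ cong₂ _+_ (sum-replicate-1 k) (sum-map-suc ds) ⟩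
  k + (length ds + sum ds)                ≡⟨ +-assoc k (length ds) (sum ds) ⟨
  k + length ds + sum ds                  ≡⟨ cong (_+ sum ds) (m∸n+n≡m l) ⟩
  m + sum ds                              ∎
  where
  open ≡-Reasoning
  k : ℕ
  k = m ∸ length ds

length-unpad : ∀ xs → length (unpad xs) ≤ length xs
length-unpad xs = ≤-trans (length-filter (0 <?_) (map pred xs)) (≤-reflexive (length-map pred xs))

map-pred-pad : ∀ m ds → map pred (pad m ds) ≡ replicate (m ∸ length ds) 0 ++ ds
map-pred-pad m ds = begin
  map pred (replicate k 1 ++ map suc ds)             ≡⟨ map-++ pred (replicate k 1) (map suc ds) ⟩
  map pred (replicate k 1) ++ map pred (map suc ds)  ≡⟨ cong₂ _++_ (map-replicate pred k 1) (sym (map-∘ ds)) ⟩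
  replicate k 0 ++ map id ds                         ≡⟨ cong (replicate k 0 ++_) (map-id ds) ⟩
  replicate k 0 ++ ds                                ∎
  where
  open ≡-Reasoning
  k : ℕ
  k = m ∸ length ds

unpad-pad : ∀ m {ds} → All (0 <_) ds → unpad (pad m ds) ≡ ds
unpad-pad m {ds} pos = begin
  filter (0 <?_) (map pred (pad m ds))
    ≡⟨ cong (filter (0 <?_)) (map-pred-pad m ds) ⟩
  filter (0 <?_) (replicate k 0 ++ ds)
    ≡⟨ filter-++ (0 <?_) (replicate k 0) ds ⟩
  filter (0 <?_) (replicate k 0) ++ filter (0 <?_) ds
    ≡⟨ cong₂ _++_ (filter-none (0 <?_) (All.replicate⁺ k λ ())) (filter-all (0 <?_) pos) ⟩
  ds
    ∎
  where
  open ≡-Reasoning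
  k : ℕ
  k = m ∸ length ds

pad-unpad : ∀ {xs} → Ascending xs → pad (length xs) (unpad xs) ≡ xs
pad-unpad {[]}                _             = refl
pad-unpad {zero ∷ _}          (_ , () ∷ _)
pad-unpad {suc zero ∷ xs}     (l , _ ∷ pos) =
  trans (pad-suc (unpad xs) (length-unpad xs)) (cong (1 ∷_) (pad-unpad (Linked.tail l , pos)))
pad-unpad xs@{suc (suc _) ∷ _} (l , _)      = begin
  pad (length xs) (unpad xs)               ≡⟨ cong₂ pad (sym (length-map pred xs)) unpad≡ ⟩
  pad (length (map pred xs)) (map pred xs) ≡⟨ pad-length (map pred xs) ⟩
  map suc (map pred xs)                    ≡⟨ map-∘ xs ⟨
  map (suc ∘ pred) xs                      ≡⟨ map-id-local (All.map (λ { (s≤s _) → refl }) 2≤xs) ⟩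
  xs                                       ∎
  where
  open ≡-Reasoning
  2≤xs : All (2 ≤_) xs
  2≤xs = Linked.Linked⇒All ≤-trans (s≤s (s≤s z≤n)) l
  unpad≡ : unpad xs ≡ map pred xs
  unpad≡ = filter-all (0 <?_) (All.map⁺ (All.map pred-mono-≤ 2≤xs))

Ascending-unpad : ∀ {xs} → Linked _≤_ xs → Ascending (unpad xs)
Ascending-unpad {xs} l =
  Linked.filter⁺ (0 <?_) ≤-trans (Linked.map⁺ (Linked.map pred-mono-≤ l)) , All.all-filter (0 <?_) (map pred xs)

pad-AscPartition : ∀ {m u ds} → AscPartitionAtMost m u ds → AscPartition m u (pad m ds)
pad-AscPartition {m} {ds = ds} ((l , pos) , length≤ , sum≡) =
  Ascending-ones++ _ (Ascending-map-suc l) , length-pad m ds length≤ , trans (sum-pad m ds length≤) sum≡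

unpad-AscPartitionAtMost : ∀ {m u xs} → AscPartition m u xs → AscPartitionAtMost m u (unpad xs)
unpad-AscPartitionAtMost {m} {xs = xs} (asc@(l , _) , refl , sum≡) =
  Ascending-unpad l , length-unpad xs ,
  trans (sym (sum-pad m (unpad xs) (length-unpad xs))) (trans (cong sum (pad-unpad asc)) sum≡)

IsAscPartition : ℕ → List ℕ → Set
IsAscPartition u xs = Linked _≤_ xs × sum xs ≡ u

isAscPartition? : (u : ℕ) → Decidable (IsAscPartition u)
isAscPartition? u xs = Linked.linked? _≤?_ xs ×-dec (sum xs ≟ u)

∈-ascPartitions⁻ : ∀ {m u xs} → xs ∈ filter (isAscPartition? u) (tuples u m) → AscPartition m u xs
∈-ascPartitions⁻ {m} {u} xs∈ with xs∈tuples , (l , sum≡) ← ∈-filter⁻ (isAscPartition? u) {xs = tuples u m} xs∈ =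
  let length≡ , inRange = ∈-tuples⁻ u m xs∈tuples in (l , All.map proj₁ inRange) , length≡ , sum≡

∈-ascPartitions⁺ : ∀ {m u xs} → AscPartition m u xs → xs ∈ filter (isAscPartition? u) (tuples u m)
∈-ascPartitions⁺ {m} {u} {xs} ((l , pos) , length≡ , sum≡) =
  ∈-filter⁺ (isAscPartition? u) {xs = tuples u m}
    (∈-tuples⁺ u m length≡
      (All.zipWith (λ (0<x , x≤sum) → 0<x , ≤-trans x≤sum (≤-reflexive sum≡)) (pos , All-≤-sum xs)))
    (l , sum≡)

length-𝓕 : ∀ m u → length (𝓕 (suc u) (suc m)) ≡ length (filter (isAscPartition? u) (tuples u m))
length-𝓕 m u = length-≡-by-inverse encode decode
  (Unique.filter⁺ (inF? (suc u) (suc m)) (subsetsUpTo-unique (suc u)))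
  (Unique.filter⁺ (isAscPartition? u) (tuples-unique u m))
  (λ F∈ → ∈-ascPartitions⁺ (pad-AscPartition (proj₂ (∈-𝓕⁻ F∈))))
  (λ xs∈ → ∈-𝓕⁺ (unpad-AscPartitionAtMost (∈-ascPartitions⁻ xs∈)))
  decode∘encode
  (λ xs∈ → encode∘decode (∈-ascPartitions⁻ xs∈))
  where
  encode decode : List ℕ → List ℕ
  encode = pad m ∘ gaps
  decode = scanl _+_ (suc m) ∘ unpad
  decode∘encode : ∀ {F} → F ∈ 𝓕 (suc u) (suc m) → decode (encode F) ≡ F
  decode∘encode F∈ with F≡ , ((_ , pos) , _) ← ∈-𝓕⁻ {m} {u} F∈ =
    trans (cong (scanl _+_ (suc m)) (unpad-pad m pos)) (sym F≡)
  encode∘decode : ∀ {xs} → AscPartition m u xs → encode (decode xs) ≡ xs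
  encode∘decode {xs} (asc , refl , _) =
    trans (cong (pad (length xs)) (gaps-scanl (suc (length xs)) (unpad xs))) (pad-unpad asc)

NonIncreasing⇒Linked : ∀ xs → NonIncreasing xs → Linked _≥_ xs
NonIncreasing⇒Linked []           _       = []
NonIncreasing⇒Linked (_ ∷ [])     _       = [-]
NonIncreasing⇒Linked (_ ∷ y ∷ xs) (r , n) = r ∷ NonIncreasing⇒Linked (y ∷ xs) n

Linked⇒NonIncreasing : ∀ {xs} → Linked _≥_ xs → NonIncreasing xs
Linked⇒NonIncreasing []      = tt
Linked⇒NonIncreasing [-]     = tt
Linked⇒NonIncreasing (r ∷ l) = r , Linked⇒NonIncreasing l

reverse-∈-filter-tuples : ∀ {P Q : Pred (List ℕ) 0ℓ} (P? : Decidable P) (Q? : Decidable Q) →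
                          (∀ {xs} → P xs → Q (reverse xs)) →
                          ∀ u k {xs} → xs ∈ filter P? (tuples u k) → reverse xs ∈ filter Q? (tuples u k)
reverse-∈-filter-tuples P? Q? P⇒Q u k xs∈ with xs∈tuples , pxs ← ∈-filter⁻ P? {xs = tuples u k} xs∈ =
  ∈-filter⁺ Q? {xs = tuples u k} (reverse-∈-tuples u k xs∈tuples) (P⇒Q pxs)

length-ascPartitions : ∀ m u → length (filter (isAscPartition? u) (tuples u m)) ≡ p u m
length-ascPartitions m u = length-≡-by-inverse reverse reverse
  (Unique.filter⁺ (isAscPartition? u) (tuples-unique u m))
  (Unique.filter⁺ (isPartition? u) (tuples-unique u m))
  (reverse-∈-filter-tuples (isAscPartition? u) (isPartition? u) asc⇒partition u m)
  (reverse-∈-filter-tuples (isPartition? u) (isAscPartition? u) partition⇒asc u m)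
  (λ {xs} _ → reverse-involutive xs)
  (λ {xs} _ → reverse-involutive xs)
  where
  asc⇒partition : ∀ {xs} → IsAscPartition u xs → IsPartition u (reverse xs)
  asc⇒partition {xs} (l , sum≡) = Linked⇒NonIncreasing (Linked-reverse⁺ l) , trans (sum-↭ (↭-reverse xs)) sum≡
  partition⇒asc : ∀ {xs} → IsPartition u xs → IsAscPartition u (reverse xs)
  partition⇒asc {xs} (n , sum≡) = Linked-reverse⁺ (NonIncreasing⇒Linked xs n) , trans (sum-↭ (↭-reverse xs)) sum≡

proposition1p2 : (m n : ℕ) → 1 ≤ m → m ≤ n ∸ 1 → length (𝓕 n (suc m)) ≡ p (n ∸ 1) m
proposition1p2 (suc m) zero    (s≤s z≤n) ()
proposition1p2 m       (suc u) _         _  = trans (length-𝓕 m u) (length-ascPartitions m u)
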